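{- Let $\mathcal X,\mathcal Y,\mathcal Z$ be finite sets, $f\colon\mathcal X\times\mathcal Y\to\mathcal Z$ arbitrary, and $\mu$ a distribution on $\mathcal X\times\mathcal Y$. Then $\mu$ is not structurally internal-trivial if and only if there exists a connected component $C$ of $G_\mu$ such that $f$ is not constant on $C_A\times C_B$.
   Context: $G$ is the graph on vertex set $\mathcal X\times\mathcal Y$ in which two distinct vertices are adjacent iff they agree in one coordinate (i.e. $(x,y)\sim(x,y')$ for $y\ne y'$ and $(x,y)\sim(x',y)$ for $x\ne x'$). $G_\mu$ is the subgraph of $G$ induced on $\mathrm{supp}\,\mu$. For a connected component $C$ of $G_\mu$, $C_A=\{x:(x,y)\in C\text{ for some }y\}$ and $C_B=\{y:(x,y)\in C\text{ for some }x\}$. $\mu$ is structurally internal-trivial if, letting $S_A,S_B$ be the supports of the marginals of $\mu$ on $\mathcal X$ and $\mathcal Y$, there are partitions $S_A=\bigcup_i\mathcal X_i$, $S_B=\bigcup_i\mathcal Y_i$ (same index set) with $\mathrm{supp}\,\mu\subseteq\bigcup_i\mathcal X_i\times\mathcal Y_i$ and $f$ constant on each $\mathcal X_i\times\mathcal Y_i$.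
   Formalization: The distribution μ on $\mathcal X\times\mathcal Y$ takes only rational values. -}

module Defs where

open import Data.Nat using (ℕ; zero; suc)
open import Data.Fin using (Fin; zero; suc)
open import Data.Product using (_×_; _,_; ∃; ∃-syntax; Σ)
open import Data.Sum using (_⊎_)
open import Data.Rational using (ℚ; 0ℚ; 1ℚ; _+_; _≤_; _<_)
open import Relation.Binary.PropositionalEquality using (_≡_; _≢_)
open import Relation.Binary.Construct.Closure.ReflexiveTransitive using (Star)
open import Relation.Nullary using (¬_)

sumFin : {n : ℕ} → (Fin n → ℚ) → ℚ
sumFin {zero}  g = 0ℚ
sumFin {suc n} g = g zero + sumFin (λ i → g (suc i))

IsDistribution : {m n : ℕ} → (Fin m → Fin n → ℚ) → Set
IsDistribution {m} {n} μ =
  (∀ x y → 0ℚ ≤ μ x y) × (sumFin (λ x → sumFin (λ y → μ x y)) ≡ 1ℚ)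

module _ {m n : ℕ} (μ : Fin m → Fin n → ℚ) where

  Supp : Fin m × Fin n → Set
  Supp (x , y) = 0ℚ < μ x y

  marginalA : Fin m → ℚ
  marginalA x = sumFin (λ y → μ x y)

  marginalB : Fin n → ℚ
  marginalB y = sumFin (λ x → μ x y)

  SA : Fin m → Set
  SA x = 0ℚ < marginalA x

  SB : Fin n → Set
  SB y = 0ℚ < marginalB y

  EdgeGμ : Fin m × Fin n → Fin m × Fin n → Set
  EdgeGμ (x , y) (x' , y') =
    Supp (x , y) × Supp (x' , y') ×
    ((x ≡ x' × y ≢ y') ⊎ (y ≡ y' × x ≢ x'))

  SameComponent : Fin m × Fin n → Fin m × Fin n → Set
  SameComponent v w = Star EdgeGμ v w

  -- C_A and C_B of the component C containing v
  CompA : Fin m × Fin n → Fin m → Set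
  CompA v x = ∃[ y ] (Supp (x , y) × SameComponent v (x , y))

  CompB : Fin m × Fin n → Fin n → Set
  CompB v y = ∃[ x ] (Supp (x , y) × SameComponent v (x , y))

  -- Partitions S_A = ⋃_{i<k} X_i and
  -- S_B = ⋃_{i<k} Y_i (common index set Fin k) are given by block-labelling
  -- maps α, β (only their values on S_A, S_B matter): X_i = {x ∈ S_A : α x = i}.
  StructurallyInternalTrivial : {p : ℕ} → (Fin m → Fin n → Fin p) → Set
  StructurallyInternalTrivial f =
    ∃[ k ] Σ (Fin m → Fin k) λ α → Σ (Fin n → Fin k) λ β →
      (∀ x y → Supp (x , y) → α x ≡ β y) ×
      (∀ x x' y y' → SA x → SA x' → SB y → SB y' →
         α x ≡ β y → α x' ≡ β y' → α x ≡ α x' →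
         f x y ≡ f x' y')

-- Any block labelling of a structurally internal-trivial μ is constant along edges of G_μ, since an edge stays
-- in a row or a column and a supported cell puts its row and column in the same block; hence all rows and
-- columns of a component lie in one block, on which f is constant. Conversely, label each row and column by
-- the least row met by the component of any of its supported cells: equal labels force a common component,
-- so if f is constant on every C_A × C_B these labels are a structurally internal-trivial partition.
-- Connectivity in the finite graph G_μ is decidable, which makes the contrapositive constructive.
module Submission where

import Level
open import Data.Nat using (ℕ; zero; suc)
open import Data.Fin using (Fin; zero; suc; lift)
open import Data.Fin.Properties using (any?) renaming (_≟_ to _≟ᶠ_)
open import Data.List using (List; []; _∷_; allFin; cartesianProduct)
open import Data.List.Membership.Propositional using (_∈_)
open import Data.List.Membership.Propositional.Properties using (∈-allFin; ∈-cartesianProduct⁺)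
open import Data.List.Relation.Unary.Any using (here; there)
open import Data.Product using (_×_; _,_; ∃-syntax; Σ; proj₁; uncurry)
open import Data.Product.Properties using (≡-dec)
open import Data.Sum using (_⊎_; inj₁; inj₂; [_,_])
open import Data.Empty using (⊥-elim)
open import Data.Rational using (ℚ; 0ℚ; _≤_; _<_)
import Data.Rational.Properties as ℚ
open import Relation.Nullary using (Dec; yes; no; ¬_)
open import Relation.Nullary.Decidable using (_×-dec_; _⊎-dec_; map′; ¬?; decidable-stable)
open import Relation.Unary using (Pred; Decidable)
open import Relation.Binary.PropositionalEquality using (_≡_; _≢_; refl; sym; trans; cong)
open import Relation.Binary.Construct.Closure.ReflexiveTransitive using (Star; ε; _◅_; _◅◅_; reverse)
open import Function.Base using (_∘_)
open import Function.Bundles using (_⇔_; mk⇔; Equivalence)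
open import Defs

sumFin-nonneg : ∀ {k} (g : Fin k → ℚ) → (∀ i → 0ℚ ≤ g i) → 0ℚ ≤ sumFin g
sumFin-nonneg {zero}  g g≥0 = ℚ.≤-refl
sumFin-nonneg {suc k} g g≥0 = ℚ.+-mono-≤ (g≥0 zero) (sumFin-nonneg (λ i → g (suc i)) (λ i → g≥0 (suc i)))

sumFin-nonpos : ∀ {k} (g : Fin k → ℚ) → (∀ i → g i ≤ 0ℚ) → sumFin g ≤ 0ℚ
sumFin-nonpos {zero}  g g≤0 = ℚ.≤-refl
sumFin-nonpos {suc k} g g≤0 = ℚ.+-mono-≤ (g≤0 zero) (sumFin-nonpos (λ i → g (suc i)) (λ i → g≤0 (suc i)))

sumFin-pos : ∀ {k} (g : Fin k → ℚ) → (∀ i → 0ℚ ≤ g i) → ∀ i → 0ℚ < g i → 0ℚ < sumFin g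
sumFin-pos {suc k} g g≥0 zero    gᵢ>0 = ℚ.+-mono-<-≤ gᵢ>0 (sumFin-nonneg (λ i → g (suc i)) (λ i → g≥0 (suc i)))
sumFin-pos {suc k} g g≥0 (suc i) gᵢ>0 = ℚ.+-mono-≤-< (g≥0 zero) (sumFin-pos (λ i → g (suc i)) (λ i → g≥0 (suc i)) i gᵢ>0)

sumFin-pos⇒∃pos : ∀ {k} (g : Fin k → ℚ) → 0ℚ < sumFin g → ∃[ i ] 0ℚ < g i
sumFin-pos⇒∃pos g sum>0 = decidable-stable (any? (λ i → 0ℚ ℚ.<? g i)) λ ∄pos →
  ℚ.<-irrefl refl (ℚ.<-≤-trans sum>0 (sumFin-nonpos g (λ i → ℚ.≮⇒≥ (λ gᵢ>0 → ∄pos (i , gᵢ>0)))))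

-- The index of the first witness of P, shifted by one; zero means there is none.
firstWitness : ∀ {k p} {P : Pred (Fin k) p} → Decidable P → Fin (suc k)
firstWitness {zero}  P? = zero
firstWitness {suc k} P? with P? zero
... | yes _ = suc zero
... | no  _ = lift 1 suc (firstWitness (λ j → P? (suc j)))

firstWitness-sound : ∀ {k p} {P : Pred (Fin k) p} (P? : Decidable P) {j} → firstWitness P? ≡ suc j → P j
firstWitness-sound {suc k} P? eq with P? zero
firstWitness-sound P? {zero}  refl | yes p = p
firstWitness-sound P? {suc j} ()   | yes _
... | no _ with firstWitness (λ j → P? (suc j)) in e
firstWitness-sound P? {zero}  () | no _ | zero
firstWitness-sound P? {zero}  () | no _ | suc _
firstWitness-sound P? {suc j} () | no _ | zero
firstWitness-sound P? {suc j} refl | no _ | suc .j = firstWitness-sound (λ j → P? (suc j)) e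

firstWitness-complete : ∀ {k p} {P : Pred (Fin k) p} (P? : Decidable P) {i} → P i → ∃[ j ] firstWitness P? ≡ suc j
firstWitness-complete {suc k} P? pᵢ with P? zero
... | yes _ = zero , refl
firstWitness-complete P? {zero}  p₀ | no ¬p₀ = ⊥-elim (¬p₀ p₀)
firstWitness-complete P? {suc i} pᵢ | no _ with firstWitness-complete (λ j → P? (suc j)) pᵢ
... | j , e rewrite e = suc j , refl

firstWitness-cong : ∀ {k p q} {P : Pred (Fin k) p} {Q : Pred (Fin k) q} (P? : Decidable P) (Q? : Decidable Q) →
  (∀ j → P j ⇔ Q j) → firstWitness P? ≡ firstWitness Q?
firstWitness-cong {zero}  P? Q? P⇔Q = refl
firstWitness-cong {suc k} P? Q? P⇔Q with P? zero | Q? zero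
... | yes _  | yes _  = refl
... | yes p₀ | no ¬q₀ = ⊥-elim (¬q₀ (Equivalence.to (P⇔Q zero) p₀))
... | no ¬p₀ | yes q₀ = ⊥-elim (¬p₀ (Equivalence.from (P⇔Q zero) q₀))
... | no _   | no _   = cong (lift 1 suc) (firstWitness-cong (λ j → P? (suc j)) (λ j → Q? (suc j)) (λ j → P⇔Q (suc j)))

-- Floyd–Warshall: reachability is decided by adding the vertices of an enumeration one at a time
-- to the set of allowed intermediate vertices.
module FiniteReachability {a r} {A : Set a} (R : A → A → Set r)
  (_≟_ : (u w : A) → Dec (u ≡ w)) (R? : (u w : A) → Dec (R u w))
  (vertices : List A) (∈-vertices : (u : A) → u ∈ vertices) where

  data PathVia (S : List A) : A → A → Set (a Level.⊔ r) where
    direct : ∀ {u w}   → u ≡ w ⊎ R u w → PathVia S u w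
    via    : ∀ {u v w} → R u v → v ∈ S → PathVia S v w → PathVia S u w

  weaken : ∀ {z S u w} → PathVia S u w → PathVia (z ∷ S) u w
  weaken (direct d)    = direct d
  weaken (via e v∈S p) = via e (there v∈S) (weaken p)

  join : ∀ {z S u w} → PathVia S u z → PathVia S z w → PathVia (z ∷ S) u w
  join (direct (inj₁ refl)) q = weaken q
  join (direct (inj₂ e))    q = via e (here refl) (weaken q)
  join (via e v∈S p)        q = via e (there v∈S) (join p q)

  split : ∀ {z S u w} → PathVia (z ∷ S) u w → PathVia S u w ⊎ (PathVia S u z × PathVia S z w)
  split (direct d) = inj₁ (direct d)
  split (via e (here refl) p) with split p
  ... | inj₁ q       = inj₂ (direct (inj₂ e) , q)
  ... | inj₂ (_ , q) = inj₂ (direct (inj₂ e) , q)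
  split (via e (there v∈S) p) with split p
  ... | inj₁ q        = inj₁ (via e v∈S q)
  ... | inj₂ (q , q′) = inj₂ (via e v∈S q , q′)

  pathVia? : ∀ S u w → Dec (PathVia S u w)
  pathVia? []      u w = map′ direct (λ { (direct d) → d ; (via _ () _) }) ((u ≟ w) ⊎-dec R? u w)
  pathVia? (z ∷ S) u w = map′ [ weaken , uncurry join ] split
    (pathVia? S u w ⊎-dec (pathVia? S u z ×-dec pathVia? S z w))

  PathVia⇒Star : ∀ {S u w} → PathVia S u w → Star R u w
  PathVia⇒Star (direct (inj₁ refl)) = ε
  PathVia⇒Star (direct (inj₂ e))    = e ◅ ε
  PathVia⇒Star (via e _ p)          = e ◅ PathVia⇒Star p

  Star⇒PathVia : ∀ {u w} → Star R u w → PathVia vertices u w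
  Star⇒PathVia ε                 = direct (inj₁ refl)
  Star⇒PathVia (_◅_ {j = v} e p) = via e (∈-vertices v) (Star⇒PathVia p)

  star? : ∀ u w → Dec (Star R u w)
  star? u w = map′ PathVia⇒Star Star⇒PathVia (pathVia? vertices u w)

module Components {m n : ℕ} (μ : Fin m → Fin n → ℚ) where

  Cell : Set
  Cell = Fin m × Fin n

  supp? : ∀ v → Dec (Supp μ v)
  supp? (x , y) = 0ℚ ℚ.<? μ x y

  edge? : ∀ v w → Dec (EdgeGμ μ v w)
  edge? (x , y) (x′ , y′) = supp? (x , y) ×-dec (supp? (x′ , y′) ×-dec
    (((x ≟ᶠ x′) ×-dec ¬? (y ≟ᶠ y′)) ⊎-dec ((y ≟ᶠ y′) ×-dec ¬? (x ≟ᶠ x′))))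

  open FiniteReachability (EdgeGμ μ) (≡-dec _≟ᶠ_ _≟ᶠ_) edge? (cartesianProduct (allFin m) (allFin n))
    (λ (x , y) → ∈-cartesianProduct⁺ (∈-allFin x) (∈-allFin y))
    renaming (star? to sameComponent?)
    using ()
    public

  edge-sym : ∀ {v w} → EdgeGμ μ v w → EdgeGμ μ w v
  edge-sym (s , s′ , inj₁ (x≡x′ , y≢y′)) = s′ , s , inj₁ (sym x≡x′ , λ y′≡y → y≢y′ (sym y′≡y))
  edge-sym (s , s′ , inj₂ (y≡y′ , x≢x′)) = s′ , s , inj₂ (sym y≡y′ , λ x′≡x → x≢x′ (sym x′≡x))

  sameComponent-sym : ∀ {v w} → SameComponent μ v w → SameComponent μ w v
  sameComponent-sym = reverse edge-sym

  sameRow⇒sameComponent : ∀ {x y y′} → Supp μ (x , y) → Supp μ (x , y′) → SameComponent μ (x , y) (x , y′)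
  sameRow⇒sameComponent {y = y} {y′} s s′ with y ≟ᶠ y′
  ... | yes refl = ε
  ... | no y≢y′  = (s , s′ , inj₁ (refl , y≢y′)) ◅ ε

  sameColumn⇒sameComponent : ∀ {x x′ y} → Supp μ (x , y) → Supp μ (x′ , y) → SameComponent μ (x , y) (x′ , y)
  sameColumn⇒sameComponent {x = x} {x′} s s′ with x ≟ᶠ x′
  ... | yes refl = ε
  ... | no x≢x′  = (s , s′ , inj₂ (refl , x≢x′)) ◅ ε

  anyCell? : ∀ {ℓ} {P : Pred Cell ℓ} → Decidable P → Dec (Σ Cell P)
  anyCell? P? = map′ (λ (x , y , p) → (x , y) , p) (λ ((x , y) , p) → x , y , p)
    (any? λ x → any? λ y → P? (x , y))

  supp⇒SA : (∀ x y → 0ℚ ≤ μ x y) → ∀ {x y} → Supp μ (x , y) → SA μ x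
  supp⇒SA μ≥0 {x} {y} = sumFin-pos (μ x) (μ≥0 x) y

  supp⇒SB : (∀ x y → 0ℚ ≤ μ x y) → ∀ {x y} → Supp μ (x , y) → SB μ y
  supp⇒SB μ≥0 {x} {y} = sumFin-pos (λ x → μ x y) (λ x → μ≥0 x y) x

  SA⇒supp : ∀ {x} → SA μ x → ∃[ y ] Supp μ (x , y)
  SA⇒supp {x} = sumFin-pos⇒∃pos (μ x)

  SB⇒supp : ∀ {y} → SB μ y → ∃[ x ] Supp μ (x , y)
  SB⇒supp {y} = sumFin-pos⇒∃pos (λ x → μ x y)

  compA? : ∀ v x → Dec (CompA μ v x)
  compA? v x = any? λ y → supp? (x , y) ×-dec sameComponent? v (x , y)

  compB? : ∀ v y → Dec (CompB μ v y)
  compB? v y = any? λ x → supp? (x , y) ×-dec sameComponent? v (x , y)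

  compA-transport : ∀ {v w x} → SameComponent μ v w → CompA μ w x → CompA μ v x
  compA-transport v~w (y , s , w~xy) = y , s , v~w ◅◅ w~xy

  label : Cell → Fin (suc m)
  label v = firstWitness (compA? v)

  rowLabel : Fin m → Fin (suc m)
  rowLabel x = firstWitness λ j → any? λ y → supp? (x , y) ×-dec compA? (x , y) j

  columnLabel : Fin n → Fin (suc m)
  columnLabel y = firstWitness λ j → any? λ x → supp? (x , y) ×-dec compA? (x , y) j

  rowLabel-supp : ∀ {x y} → Supp μ (x , y) → rowLabel x ≡ label (x , y)
  rowLabel-supp s = firstWitness-cong _ _ λ j → mk⇔
    (λ (y′ , s′ , c) → compA-transport (sameRow⇒sameComponent s s′) c)
    (λ c → _ , s , c)

  columnLabel-supp : ∀ {x y} → Supp μ (x , y) → columnLabel y ≡ label (x , y)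
  columnLabel-supp s = firstWitness-cong _ _ λ j → mk⇔
    (λ (x′ , s′ , c) → compA-transport (sameColumn⇒sameComponent s s′) c)
    (λ c → _ , s , c)

  sameLabel⇒sameComponent : ∀ {v w} → Supp μ v → Supp μ w → label v ≡ label w → SameComponent μ v w
  sameLabel⇒sameComponent {x , y} {w} s t lv≡lw with firstWitness-complete (compA? (x , y)) (y , s , ε)
  ... | j , lv≡j with firstWitness-sound (compA? (x , y)) lv≡j | firstWitness-sound (compA? w) (trans (sym lv≡lw) lv≡j)
  ... | (b , sb , v~jb) | (b′ , sb′ , w~jb′) = v~jb ◅◅ sameRow⇒sameComponent sb sb′ ◅◅ sameComponent-sym w~jb′

  consistentLabelling-constant : ∀ {k} (α : Fin m → Fin k) (β : Fin n → Fin k) →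
    (∀ x y → Supp μ (x , y) → α x ≡ β y) → ∀ {v w} → SameComponent μ v w → α (proj₁ v) ≡ α (proj₁ w)
  consistentLabelling-constant α β α≡β ε = refl
  consistentLabelling-constant α β α≡β (e ◅ p) = trans (edge e) (consistentLabelling-constant α β α≡β p)
    where
    edge : ∀ {v w} → EdgeGμ μ v w → α (proj₁ v) ≡ α (proj₁ w)
    edge (_ , _ , inj₁ (refl , _)) = refl
    edge {x , y} {x′ , _} (s , s′ , inj₂ (refl , _)) = trans (α≡β x y s) (sym (α≡β x′ y s′))

module _ {m n p : ℕ} (f : Fin m → Fin n → Fin p) (μ : Fin m → Fin n → ℚ) where

  open Components μ

  NonConstantOnSomeComponent : Set
  NonConstantOnSomeComponent = Σ Cell λ v → Supp μ v ×
    ∃[ x ] ∃[ x′ ] ∃[ y ] ∃[ y′ ] (CompA μ v x × CompA μ v x′ × CompB μ v y × CompB μ v y′ × f x y ≢ f x′ y′)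

  nonConstantOnSomeComponent? : Dec NonConstantOnSomeComponent
  nonConstantOnSomeComponent? = anyCell? λ v → supp? v ×-dec
    any? λ x → any? λ x′ → any? λ y → any? λ y′ →
      compA? v x ×-dec compA? v x′ ×-dec compB? v y ×-dec compB? v y′ ×-dec ¬? (f x y ≟ᶠ f x′ y′)

  nonConstant⇒¬trivial : (∀ x y → 0ℚ ≤ μ x y) → NonConstantOnSomeComponent → ¬ StructurallyInternalTrivial μ f
  nonConstant⇒¬trivial μ≥0 (v , _ , x , x′ , y , y′ , (_ , s₁ , c₁) , (_ , s₂ , c₂) , (_ , s₃ , c₃) , (_ , s₄ , c₄) , fxy≢fx′y′)
                       (_ , α , β , α≡β , fConstant) =
    fxy≢fx′y′ (fConstant x x′ y y′ (supp⇒SA μ≥0 s₁) (supp⇒SA μ≥0 s₂) (supp⇒SB μ≥0 s₃) (supp⇒SB μ≥0 s₄)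
      (trans (αv≡ c₁) (trans (sym (αv≡ c₃)) (α≡β _ y s₃)))
      (trans (αv≡ c₂) (trans (sym (αv≡ c₄)) (α≡β _ y′ s₄)))
      (trans (αv≡ c₁) (sym (αv≡ c₂))))
    where
    αv≡ : ∀ {w} → SameComponent μ v w → α (proj₁ w) ≡ α (proj₁ v)
    αv≡ c = sym (consistentLabelling-constant α β α≡β c)

  ¬nonConstant⇒trivial : ¬ NonConstantOnSomeComponent → StructurallyInternalTrivial μ f
  ¬nonConstant⇒trivial constant = suc m , rowLabel , columnLabel , rowLabel≡columnLabel , fConstant
    where
    rowLabel≡columnLabel : ∀ x y → Supp μ (x , y) → rowLabel x ≡ columnLabel y
    rowLabel≡columnLabel x y s = trans (rowLabel-supp s) (sym (columnLabel-supp s))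

    fConstant : ∀ x x′ y y′ → SA μ x → SA μ x′ → SB μ y → SB μ y′ →
      rowLabel x ≡ columnLabel y → rowLabel x′ ≡ columnLabel y′ → rowLabel x ≡ rowLabel x′ → f x y ≡ f x′ y′
    fConstant x x′ y y′ sa sa′ sb sb′ e₁ e₂ e₃
      with y₁ , s₁ ← SA⇒supp sa | y₂ , s₂ ← SA⇒supp sa′ | x₃ , s₃ ← SB⇒supp sb | x₄ , s₄ ← SB⇒supp sb′ =
      decidable-stable (f x y ≟ᶠ f x′ y′) λ fxy≢fx′y′ → constant
        ((x , y₁) , s₁ , x , x′ , y , y′ , (y₁ , s₁ , ε)
        , (y₂ , s₂ , linked s₂ (rowLabel-supp s₂) e₃)
        , (x₃ , s₃ , linked s₃ (columnLabel-supp s₃) e₁)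
        , (x₄ , s₄ , linked s₄ (columnLabel-supp s₄) (trans e₃ e₂))
        , fxy≢fx′y′)
      where
      linked : ∀ {w ℓ} → Supp μ w → ℓ ≡ label w → rowLabel x ≡ ℓ → SameComponent μ (x , y₁) w
      linked t ℓ≡lw lx≡ℓ = sameLabel⇒sameComponent s₁ t (trans (sym (rowLabel-supp s₁)) (trans lx≡ℓ ℓ≡lw))

mainTheorem18 : (m n p : ℕ) (f : Fin m → Fin n → Fin p) (μ : Fin m → Fin n → ℚ) →
    IsDistribution μ →
    (¬ StructurallyInternalTrivial μ f)
      ⇔ (Σ (Fin m × Fin n) λ v → Supp μ v ×
           (∃[ x ] ∃[ x' ] ∃[ y ] ∃[ y' ]
              (CompA μ v x × CompA μ v x' × CompB μ v y × CompB μ v y' × f x y ≢ f x' y')))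
mainTheorem18 m n p f μ (μ≥0 , _) = mk⇔
  (λ ¬trivial → decidable-stable (nonConstantOnSomeComponent? f μ) (¬trivial ∘ ¬nonConstant⇒trivial f μ))
  (nonConstant⇒¬trivial f μ μ≥0)
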